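{- Let $G$ be a threshold graph with binary string $b=0^{s_1}1^{t_1}0^{s_2}1^{t_2}\cdots0^{s_k}1^{t_k}$, where $k\ge1$ and all $s_i,t_i\ge1$, and let $S$ be its Seidel matrix. Let $n_{ -1}(S)$ denote the multiplicity of $-1$ as an eigenvalue of $S$. Then $$n_{ -1}(S)=\begin{cases}\sum_{i=1}^k s_i-k, & \text{if } t_k>1,\\ \sum_{i=1}^k s_i-k+1, & \text{if } t_k=1.\end{cases}$$
   Context: A threshold graph is built from a single vertex by repeatedly adding either an isolated vertex or a dominating vertex; its binary string $\alpha_1\cdots\alpha_n$ has $\alpha_1=0$ and, for $i\ge2$, $\alpha_i=0$ if the $i$-th vertex was added isolated and $\alpha_i=1$ if added dominating (adjacent to all earlier vertices). The notation $0^{s}$ (resp. $1^{t}$) denotes a run of $s$ zeros (resp. $t$ ones). The Seidel matrix of a graph with adjacency matrix $A$ is $S=J-I-2A$, with $J$ the all-ones matrix. -}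

module Defs where

open import Data.Nat as ℕ using (ℕ; zero; suc; _<ᵇ_)
open import Data.Fin as Fin using (Fin; toℕ)
open import Data.Bool using (Bool; true; false; if_then_else_)
open import Data.List as List using (List; []; _∷_; _++_; replicate; length; lookup)
open import Data.Rational using (ℚ; 0ℚ; 1ℚ; _+_; _*_; _-_; -_)
open import Data.Product using (Σ; _×_)
open import Function using (_∘_)
open import Relation.Binary.PropositionalEquality using (_≡_)
open import Relation.Nullary using (¬_)
open import Relation.Nullary.Decidable using (⌊_⌋)

-- Binary string 0^{s_1} 1^{t_1} ... 0^{s_k} 1^{t_k}  (true = 1, false = 0)
blockString : (k : ℕ) → (Fin k → ℕ) → (Fin k → ℕ) → List Bool
blockString zero    s t = []
blockString (suc k) s t =
  replicate (s Fin.zero) false ++ (replicate (t Fin.zero) true ++ blockString k (s ∘ Fin.suc) (t ∘ Fin.suc))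

-- Threshold graph of a binary string: vertices 0..n-1 (in order of addition);
-- for i < j, vertices i and j are adjacent iff α_j = 1 (vertex j added dominating).
thresholdAdj : (b : List Bool) → Fin (length b) → Fin (length b) → Bool
thresholdAdj b i j =
  if toℕ i <ᵇ toℕ j then lookup b j
  else (if toℕ j <ᵇ toℕ i then lookup b i else false)

Matrix : ℕ → Set
Matrix n = Fin n → Fin n → ℚ

boolℚ : Bool → ℚ
boolℚ true  = 1ℚ
boolℚ false = 0ℚ

adjMatrix : (b : List Bool) → Matrix (length b)
adjMatrix b i j = boolℚ (thresholdAdj b i j)

idMatrix : (n : ℕ) → Matrix n
idMatrix n i j = boolℚ ⌊ i Fin.≟ j ⌋

onesMatrix : (n : ℕ) → Matrix n
onesMatrix n i j = 1ℚ

seidel : (b : List Bool) → Matrix (length b)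
seidel b i j =
  (onesMatrix (length b) i j - idMatrix (length b) i j) - (1ℚ + 1ℚ) * adjMatrix b i j

sumFin : (n : ℕ) → (Fin n → ℚ) → ℚ
sumFin zero    f = 0ℚ
sumFin (suc n) f = f Fin.zero + sumFin n (f ∘ Fin.suc)

mulVec : {n : ℕ} → Matrix n → (Fin n → ℚ) → Fin n → ℚ
mulVec {n} M v i = sumFin n (λ j → M i j * v j)

InEigenspace : {n : ℕ} → Matrix n → ℚ → (Fin n → ℚ) → Set
InEigenspace M λ' v = ∀ i → mulVec M v i ≡ λ' * v i

LinIndep : {n m : ℕ} → (Fin m → Fin n → ℚ) → Set
LinIndep {n} {m} vs =
  (c : Fin m → ℚ) → (∀ i → sumFin m (λ j → c j * vs j i) ≡ 0ℚ) → ∀ j → c j ≡ 0ℚ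

-- The multiplicity of λ as an eigenvalue of the (symmetric) matrix M is m:
-- the eigenspace {v ∈ ℚ^n | M v = λ v} has dimension exactly m.
EigMultiplicity : {n : ℕ} → Matrix n → ℚ → ℕ → Set
EigMultiplicity {n} M λ' m =
  Σ (Fin m → Fin n → ℚ) (λ vs → (∀ j → InEigenspace M λ' (vs j)) × LinIndep vs)
  × ((ws : Fin (suc m) → Fin n → ℚ) → (∀ j → InEigenspace M λ' (ws j)) → ¬ LinIndep ws)

sumℕ : (n : ℕ) → (Fin n → ℕ) → ℕ
sumℕ zero    f = 0
sumℕ (suc n) f = f Fin.zero ℕ.+ sumℕ n (f ∘ Fin.suc)

-- Number the vertices in the order they were added. For i < j the Seidel entry is Sᵢⱼ = 1 − 2αⱼ,
-- so row i of (S + I) v sees the earlier vertices only through the running sum aᵢ = v₀ + ⋯ + vᵢ₋₁.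
-- Subtracting neighbouring rows turns S v = −v into local conditions: nothing across 00, aᵢ = 0
-- across 10, vᵢ₊₁ = vᵢ across 11 and vᵢ₊₁ = aᵢ₊₁ across 01, plus one condition at the end. A run
-- of ones keeps a common value c while the running sum grows by c, so c = 0 unless the string
-- ends in a single 1. Hence a kernel vector of S + I is determined by its entries at the 0s followed
-- by a 0 (the last 0 of each run resets the running sum to 0), together with the final 0 when the
-- string ends in 01; these entries are free. For 0^s₁ 1^t₁ ⋯ 0^sₖ 1^tₖ that is Σ (sᵢ − 1) + [tₖ = 1].

module Submission where

open import Defs
open import Data.Bool using (Bool; true; false)
open import Data.Fin using (Fin; zero; suc; fromℕ; punchIn)
open import Data.Fin.Properties using (_≟_; any?)
open import Data.List using (List; []; _∷_; length; lookup; replicate; _++_)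
open import Data.Nat using (ℕ; zero; suc)
open import Data.Product using (∃; _×_; _,_; proj₁; proj₂)
open import Data.Rational using (-_; 1ℚ)
open import Function using (_∘_)
open import Relation.Binary.PropositionalEquality
  using (_≡_; refl; sym; trans; cong; cong₂; subst; module ≡-Reasoning)
open import Relation.Nullary using (¬_; yes; no; ¬?)
open import Relation.Nullary.Decidable using (⌊⌋-map′; decidable-stable)

freeCount : List Bool → ℕ
freeCount []                     = 0
freeCount (true ∷ r)             = freeCount r
freeCount (false ∷ [])           = 0
freeCount (false ∷ false ∷ r)    = suc (freeCount (false ∷ r))
freeCount (false ∷ true ∷ [])    = 1
freeCount (false ∷ true ∷ y ∷ r) = freeCount (true ∷ y ∷ r)

freeCoordinate : (b : List Bool) → Fin (freeCount b) → Fin (length b)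
freeCoordinate (true ∷ r)             l       = suc (freeCoordinate r l)
freeCoordinate (false ∷ false ∷ r)    zero    = zero
freeCoordinate (false ∷ false ∷ r)    (suc l) = suc (freeCoordinate (false ∷ r) l)
freeCoordinate (false ∷ true ∷ [])    zero    = zero
freeCoordinate (false ∷ true ∷ y ∷ r) l       = suc (freeCoordinate (true ∷ y ∷ r) l)

-- The rational development lives in its own modules so that _+_ and _*_ can mean ℚ there and ℕ
-- in the counting at the end.
module RationalLinearAlgebra where

  open import Algebra.Bundles using (Ring)
  open import Data.Rational using (ℚ; 0ℚ; _+_; _*_; _-_; 1/_; NonZero; ≢-nonZero)
  import Data.Rational.Properties as ℚ
  open import Data.Vec.Functional using (insertAt)
  open import Data.Vec.Functional.Properties using (insertAt-lookup; insertAt-punchIn)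
  open import Level using (0ℓ)
  open import Tactic.RingSolver using (solve-∀)
  open import Relation.Nullary.Decidable using (dec⇒maybe)
  open import Tactic.RingSolver.Core.AlmostCommutativeRing
    using (AlmostCommutativeRing; fromCommutativeRing)
  open import Algebra.Properties.Semiring.Sum (Ring.semiring ℚ.+-*-ring)
    using (sum; sum-cong-≗; sum-replicate-zero; ∑-distrib-+; ∑-comm; sum-remove;
           *-distribˡ-sum; *-distribʳ-sum)
  open ≡-Reasoning

  ℚ-ring : AlmostCommutativeRing 0ℓ 0ℓ
  ℚ-ring = fromCommutativeRing ℚ.+-*-commutativeRing (λ p → dec⇒maybe (0ℚ ℚ.≟ p))

  sumFin≡sum : ∀ n (f : Fin n → ℚ) → sumFin n f ≡ sum f
  sumFin≡sum zero    f = refl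
  sumFin≡sum (suc n) f = cong (f zero +_) (sumFin≡sum n (f ∘ suc))

  sumFin-cong : ∀ n {f g : Fin n → ℚ} → (∀ i → f i ≡ g i) → sumFin n f ≡ sumFin n g
  sumFin-cong n {f} {g} f≗g = begin
    sumFin n f ≡⟨ sumFin≡sum n f ⟩
    sum f      ≡⟨ sum-cong-≗ f≗g ⟩
    sum g      ≡⟨ sumFin≡sum n g ⟨
    sumFin n g ∎

  sumFin-zero : ∀ n {f : Fin n → ℚ} → (∀ i → f i ≡ 0ℚ) → sumFin n f ≡ 0ℚ
  sumFin-zero n {f} f≗0 = begin
    sumFin n f           ≡⟨ sumFin-cong n f≗0 ⟩
    sumFin n (λ _ → 0ℚ)  ≡⟨ sumFin≡sum n (λ _ → 0ℚ) ⟩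
    sum {n} (λ _ → 0ℚ)   ≡⟨ sum-replicate-zero n ⟩
    0ℚ                   ∎

  sumFin-distrib-+ : ∀ n (f g : Fin n → ℚ) →
                     sumFin n (λ i → f i + g i) ≡ sumFin n f + sumFin n g
  sumFin-distrib-+ n f g = begin
    sumFin n (λ i → f i + g i) ≡⟨ sumFin≡sum n _ ⟩
    sum (λ i → f i + g i)      ≡⟨ ∑-distrib-+ f g ⟩
    sum f + sum g              ≡⟨ cong₂ _+_ (sumFin≡sum n f) (sumFin≡sum n g) ⟨
    sumFin n f + sumFin n g    ∎

  *-distribˡ-sumFin : ∀ n a (f : Fin n → ℚ) → a * sumFin n f ≡ sumFin n (λ i → a * f i)
  *-distribˡ-sumFin n a f = begin
    a * sumFin n f           ≡⟨ cong (a *_) (sumFin≡sum n f) ⟩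
    a * sum f                ≡⟨ *-distribˡ-sum a f ⟩
    sum (λ i → a * f i)      ≡⟨ sumFin≡sum n _ ⟨
    sumFin n (λ i → a * f i) ∎

  *-distribʳ-sumFin : ∀ n a (f : Fin n → ℚ) → sumFin n f * a ≡ sumFin n (λ i → f i * a)
  *-distribʳ-sumFin n a f = begin
    sumFin n f * a           ≡⟨ cong (_* a) (sumFin≡sum n f) ⟩
    sum f * a                ≡⟨ *-distribʳ-sum a f ⟩
    sum (λ i → f i * a)      ≡⟨ sumFin≡sum n _ ⟨
    sumFin n (λ i → f i * a) ∎

  sumFin-comm : ∀ m n (f : Fin m → Fin n → ℚ) →
                sumFin m (λ i → sumFin n (f i)) ≡ sumFin n (λ j → sumFin m (λ i → f i j))
  sumFin-comm m n f = begin
    sumFin m (λ i → sumFin n (f i))           ≡⟨ nested m n f ⟩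
    sum (λ i → sum (f i))                     ≡⟨ ∑-comm f ⟩
    sum (λ j → sum (λ i → f i j))             ≡⟨ nested n m (λ j i → f i j) ⟨
    sumFin n (λ j → sumFin m (λ i → f i j))   ∎
    where
    nested : ∀ m n (f : Fin m → Fin n → ℚ) →
             sumFin m (λ i → sumFin n (f i)) ≡ sum (λ i → sum (f i))
    nested m n f = trans (sumFin-cong m (λ i → sumFin≡sum n (f i))) (sumFin≡sum m _)

  sumFin-punchIn : ∀ n (p : Fin (suc n)) (f : Fin (suc n) → ℚ) →
                   sumFin (suc n) f ≡ f p + sumFin n (f ∘ punchIn p)
  sumFin-punchIn n p f = begin
    sumFin (suc n) f             ≡⟨ sumFin≡sum (suc n) f ⟩
    sum f                        ≡⟨ sum-remove f ⟩
    f p + sum (f ∘ punchIn p)    ≡⟨ cong (f p +_) (sumFin≡sum n _) ⟨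
    f p + sumFin n (f ∘ punchIn p) ∎

  sumFin-idMatrix : ∀ m (c : Fin m → ℚ) l → sumFin m (λ j → c j * idMatrix m j l) ≡ c l
  sumFin-idMatrix (suc m) c zero = begin
    c zero * 1ℚ + sumFin m (λ j → c (suc j) * 0ℚ) ≡⟨ cong₂ _+_ (ℚ.*-identityʳ (c zero))
                                                        (sumFin-zero m (ℚ.*-zeroʳ ∘ c ∘ suc)) ⟩
    c zero + 0ℚ                                    ≡⟨ ℚ.+-identityʳ (c zero) ⟩
    c zero                                         ∎
  sumFin-idMatrix (suc m) c (suc l) = begin
    c zero * 0ℚ + sumFin m (λ j → c (suc j) * idMatrix (suc m) (suc j) (suc l))
      ≡⟨ cong₂ _+_ (ℚ.*-zeroʳ (c zero)) (sumFin-cong m λ j →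
           cong (λ δ → c (suc j) * boolℚ δ) (⌊⌋-map′ _ _ (j ≟ l))) ⟩
    0ℚ + sumFin m (λ j → c (suc j) * idMatrix m j l)
      ≡⟨ ℚ.+-identityˡ _ ⟩
    sumFin m (λ j → c (suc j) * idMatrix m j l)
      ≡⟨ sumFin-idMatrix m (c ∘ suc) l ⟩
    c (suc l) ∎

  *-cancelˡ-≡0 : ∀ p .{{_ : NonZero p}} q → p * q ≡ 0ℚ → q ≡ 0ℚ
  *-cancelˡ-≡0 p q pq≡0 = begin
    q                ≡⟨ ℚ.*-identityˡ q ⟨
    1ℚ * q           ≡⟨ cong (_* q) (ℚ.*-inverseˡ p) ⟨
    (1/ p * p) * q   ≡⟨ ℚ.*-assoc (1/ p) p q ⟩
    1/ p * (p * q)   ≡⟨ cong (1/ p *_) pq≡0 ⟩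
    1/ p * 0ℚ        ≡⟨ ℚ.*-zeroʳ (1/ p) ⟩
    0ℚ               ∎

  linearCombination : ∀ {m n} → (Fin m → ℚ) → (Fin m → Fin n → ℚ) → Fin n → ℚ
  linearCombination {m} c vs i = sumFin m (λ j → c j * vs j i)

  InEigenspace-linearCombination : ∀ {m n} (M : Matrix n) μ c (vs : Fin m → Fin n → ℚ) →
    (∀ j → InEigenspace M μ (vs j)) → InEigenspace M μ (linearCombination c vs)
  InEigenspace-linearCombination {m} {n} M μ c vs eigen i = begin
    sumFin n (λ k → M i k * sumFin m (λ j → c j * vs j k))
      ≡⟨ sumFin-cong n (λ k → *-distribˡ-sumFin m (M i k) _) ⟩
    sumFin n (λ k → sumFin m (λ j → M i k * (c j * vs j k)))
      ≡⟨ sumFin-comm n m _ ⟩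
    sumFin m (λ j → sumFin n (λ k → M i k * (c j * vs j k)))
      ≡⟨ sumFin-cong m (λ j → trans (sumFin-cong n (λ k → swap (M i k) (c j) (vs j k)))
                                    (sym (*-distribˡ-sumFin n (c j) _))) ⟩
    sumFin m (λ j → c j * mulVec M (vs j) i)
      ≡⟨ sumFin-cong m (λ j → trans (cong (c j *_) (eigen j i)) (swap (c j) μ (vs j i))) ⟩
    sumFin m (λ j → μ * (c j * vs j i))
      ≡⟨ *-distribˡ-sumFin m μ _ ⟨
    μ * linearCombination c vs i ∎
    where
    swap : ∀ a b c → a * (b * c) ≡ b * (a * c)
    swap = solve-∀ ℚ-ring

  LinIndep-dropZeroColumn : ∀ {m n} (ws : Fin (suc m) → Fin (suc n) → ℚ) →
    (∀ j → ws j zero ≡ 0ℚ) → LinIndep ws → LinIndep (λ j i → ws (suc j) (suc i))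
  LinIndep-dropZeroColumn {m} ws column≡0 indep c combination≡0 j =
    indep (insertAt c zero 0ℚ) extended≡0 (suc j)
    where
    extended≡0 : ∀ i → linearCombination (insertAt c zero 0ℚ) ws i ≡ 0ℚ
    extended≡0 zero    = sumFin-zero (suc m) (λ q →
      trans (cong (insertAt c zero 0ℚ q *_) (column≡0 q)) (ℚ.*-zeroʳ (insertAt c zero 0ℚ q)))
    extended≡0 (suc i) = begin
      0ℚ * ws zero (suc i) + linearCombination c (λ j i → ws (suc j) (suc i)) i
        ≡⟨ cong₂ _+_ (ℚ.*-zeroˡ (ws zero (suc i))) (combination≡0 i) ⟩
      0ℚ + 0ℚ
        ≡⟨⟩
      0ℚ ∎

  eliminate : ∀ {m n} → (Fin (suc m) → Fin n → ℚ) → Fin (suc m) → (Fin m → ℚ) →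
              Fin m → Fin n → ℚ
  eliminate ws p α j i = ws (punchIn p j) i - α j * ws p i

  linearCombination-eliminate : ∀ {m n} (ws : Fin (suc m) → Fin n → ℚ) p (α c : Fin m → ℚ) i →
    linearCombination (insertAt c p (- sumFin m (λ j → c j * α j))) ws i
      ≡ linearCombination c (eliminate ws p α) i
  linearCombination-eliminate {m} ws p α c i = begin
    sumFin (suc m) (λ q → c′ q * ws q i)
      ≡⟨ sumFin-punchIn m p (λ q → c′ q * ws q i) ⟩
    c′ p * y + sumFin m (λ j → c′ (punchIn p j) * ws (punchIn p j) i)
      ≡⟨ cong₂ _+_ (cong (_* y) (insertAt-lookup c p (- S)))
                   (sumFin-cong m (λ j → cong (_* ws (punchIn p j) i)
                                              (insertAt-punchIn c p (- S) j))) ⟩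
    (- S) * y + sumFin m (λ j → c j * ws (punchIn p j) i)
      ≡⟨ cong ((- S) * y +_) (sumFin-cong m (λ j → split (c j) (ws (punchIn p j) i) (α j) y)) ⟩
    (- S) * y + sumFin m (λ j → c j * eliminate ws p α j i + (c j * α j) * y)
      ≡⟨ cong ((- S) * y +_) (sumFin-distrib-+ m _ (λ j → (c j * α j) * y)) ⟩
    (- S) * y + (linearCombination c (eliminate ws p α) i + sumFin m (λ j → (c j * α j) * y))
      ≡⟨ cong (λ z → (- S) * y + (linearCombination c (eliminate ws p α) i + z))
              (*-distribʳ-sumFin m y (λ j → c j * α j)) ⟨
    (- S) * y + (linearCombination c (eliminate ws p α) i + S * y)
      ≡⟨ cancel S y _ ⟩
    linearCombination c (eliminate ws p α) i ∎
    where
    S = sumFin m (λ j → c j * α j)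
    y = ws p i
    c′ = insertAt c p (- S)
    split : ∀ c x a y → c * x ≡ c * (x - a * y) + (c * a) * y
    split = solve-∀ ℚ-ring
    cancel : ∀ s y t → (- s) * y + (t + s * y) ≡ t
    cancel = solve-∀ ℚ-ring

  LinIndep-eliminate : ∀ {m n} (ws : Fin (suc m) → Fin (suc n) → ℚ) p (α : Fin m → ℚ) →
    (∀ j → eliminate ws p α j zero ≡ 0ℚ) → LinIndep ws →
    LinIndep (λ j i → eliminate ws p α j (suc i))
  LinIndep-eliminate {m} ws p α pivot-cleared indep c combination≡0 j = begin
    c j               ≡⟨ insertAt-punchIn c p _ j ⟨
    c′ (punchIn p j)  ≡⟨ indep c′ extended≡0 (punchIn p j) ⟩
    0ℚ                ∎
    where
    c′ = insertAt c p (- sumFin m (λ j → c j * α j))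
    reduced≡0 : ∀ i → linearCombination c (eliminate ws p α) i ≡ 0ℚ
    reduced≡0 zero    =
      sumFin-zero m (λ j → trans (cong (c j *_) (pivot-cleared j)) (ℚ.*-zeroʳ (c j)))
    reduced≡0 (suc i) = combination≡0 i
    extended≡0 : ∀ i → linearCombination c′ ws i ≡ 0ℚ
    extended≡0 i = trans (linearCombination-eliminate ws p α c i) (reduced≡0 i)

  -- Gaussian elimination on the first coordinate.
  ¬LinIndep-suc : ∀ m (ws : Fin (suc m) → Fin m → ℚ) → ¬ LinIndep ws
  ¬LinIndep-suc zero    ws indep = ℚ.1≢0 (indep (λ _ → 1ℚ) (λ ()) zero)
  ¬LinIndep-suc (suc m) ws indep with any? (λ p → ¬? (ws p zero ℚ.≟ 0ℚ))
  ... | yes (p , ws[p,0]≢0) =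
    ¬LinIndep-suc m (λ j i → eliminate ws p α j (suc i))
      (LinIndep-eliminate ws p α pivot-cleared indep)
    where
    instance
      _ : NonZero (ws p zero)
      _ = ≢-nonZero ws[p,0]≢0
    α : Fin (suc m) → ℚ
    α j = ws (punchIn p j) zero * 1/ ws p zero
    pivot-cleared : ∀ j → eliminate ws p α j zero ≡ 0ℚ
    pivot-cleared j = begin
      w - (w * 1/ π) * π  ≡⟨ cong (λ z → w - z) (ℚ.*-assoc w (1/ π) π) ⟩
      w - w * (1/ π * π)  ≡⟨ cong (λ z → w - w * z) (ℚ.*-inverseˡ π) ⟩
      w - w * 1ℚ          ≡⟨ cong (λ z → w - z) (ℚ.*-identityʳ w) ⟩
      w - w               ≡⟨ ℚ.+-inverseʳ w ⟩
      0ℚ                  ∎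
      where
      w = ws (punchIn p j) zero
      π = ws p zero
  ... | no noPivot =
    ¬LinIndep-suc m (λ j i → ws (suc j) (suc i)) (LinIndep-dropZeroColumn ws column≡0 indep)
    where
    column≡0 : ∀ p → ws p zero ≡ 0ℚ
    column≡0 p = decidable-stable (ws p zero ℚ.≟ 0ℚ) (λ ws[p,0]≢0 → noPivot (p , ws[p,0]≢0))

  EigMultiplicity-fromCoordinates : ∀ {m n} (M : Matrix n) μ
    (coordinate : Fin m → Fin n) (extend : (Fin m → ℚ) → Fin n → ℚ) →
    (∀ x → InEigenspace M μ (extend x)) →
    (∀ x l → extend x (coordinate l) ≡ x l) →
    (∀ v → InEigenspace M μ v → (∀ l → v (coordinate l) ≡ 0ℚ) → ∀ i → v i ≡ 0ℚ) →
    EigMultiplicity M μ m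
  EigMultiplicity-fromCoordinates {m} M μ coordinate extend extend-eigen extend-coordinate vanish =
    (basis , (λ j → extend-eigen (idMatrix m j)) , basis-indep) , ¬indep
    where
    basis : Fin m → _
    basis j = extend (idMatrix m j)
    basis-indep : LinIndep basis
    basis-indep c combination≡0 l = begin
      c l
        ≡⟨ sumFin-idMatrix m c l ⟨
      sumFin m (λ j → c j * idMatrix m j l)
        ≡⟨ sumFin-cong m (λ j → cong (c j *_) (extend-coordinate (idMatrix m j) l)) ⟨
      linearCombination c basis (coordinate l)
        ≡⟨ combination≡0 (coordinate l) ⟩
      0ℚ ∎
    ¬indep : ∀ ws → (∀ j → InEigenspace M μ (ws j)) → ¬ LinIndep ws
    ¬indep ws eigen indep = ¬LinIndep-suc m (λ j l → ws j (coordinate l)) restricted-indep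
      where
      restricted-indep : LinIndep (λ j l → ws j (coordinate l))
      restricted-indep c combination≡0 = indep c (vanish (linearCombination c ws)
        (InEigenspace-linearCombination M μ c ws eigen) combination≡0)

module ThresholdSeidel where

  open import Data.Rational using (ℚ; 0ℚ; _+_; _*_; _-_; Positive)
  import Data.Rational.Properties as ℚ
  open import Algebra.Properties.Group ℚ.+-0-group using (x∙y⁻¹≈ε⇒x≈y)
  open import Data.Unit using (⊤)
  open import Tactic.RingSolver using (solve-∀)
  open RationalLinearAlgebra
  open ≡-Reasoning

  seidelEntry : Bool → ℚ
  seidelEntry false = 1ℚ
  seidelEntry true  = - 1ℚ

  seidel-zero-suc : ∀ x b j → seidel (x ∷ b) zero (suc j) ≡ seidelEntry (lookup b j)
  seidel-zero-suc x b j with lookup b j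
  ... | true  = refl
  ... | false = refl

  seidel-suc-zero : ∀ x b i → seidel (x ∷ b) (suc i) zero ≡ seidelEntry (lookup b i)
  seidel-suc-zero x b i with lookup b i
  ... | true  = refl
  ... | false = refl

  seidel-suc-suc : ∀ x b i j → seidel (x ∷ b) (suc i) (suc j) ≡ seidel b i j
  seidel-suc-suc x b i j =
    cong (λ δ → (1ℚ - boolℚ δ) - (1ℚ + 1ℚ) * adjMatrix b i j) (⌊⌋-map′ _ _ (i ≟ j))

  -- Row i of (S + I) v for a suffix b of a threshold string, where a is the sum of the entries
  -- of v on the earlier vertices: each of those meets vertex i with Seidel entry seidelEntry αᵢ.
  kernelRow : (b : List Bool) → ℚ → (Fin (length b) → ℚ) → Fin (length b) → ℚ
  kernelRow b a v i = mulVec (seidel b) v i + v i + a * seidelEntry (lookup b i)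

  KernelAfter : (b : List Bool) → ℚ → (Fin (length b) → ℚ) → Set
  KernelAfter b a v = ∀ i → kernelRow b a v i ≡ 0ℚ

  InEigenspace⇒KernelAfter : ∀ b v → InEigenspace (seidel b) (- 1ℚ) v → KernelAfter b 0ℚ v
  InEigenspace⇒KernelAfter b v eigen i = begin
    mulVec (seidel b) v i + v i + 0ℚ * e  ≡⟨ cong (λ z → z + v i + 0ℚ * e) (eigen i) ⟩
    (- 1ℚ) * v i + v i + 0ℚ * e           ≡⟨ cancel (v i) e ⟩
    0ℚ                                    ∎
    where
    e = seidelEntry (lookup b i)
    cancel : ∀ w e → (- 1ℚ) * w + w + 0ℚ * e ≡ 0ℚ
    cancel = solve-∀ ℚ-ring

  KernelAfter⇒InEigenspace : ∀ b v → KernelAfter b 0ℚ v → InEigenspace (seidel b) (- 1ℚ) v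
  KernelAfter⇒InEigenspace b v kernel i = begin
    mulVec (seidel b) v i                               ≡⟨ shift (mulVec (seidel b) v i) (v i) e ⟩
    (kernelRow b 0ℚ v i) + (- 1ℚ) * v i                 ≡⟨ cong (_+ (- 1ℚ) * v i) (kernel i) ⟩
    0ℚ + (- 1ℚ) * v i                                   ≡⟨ ℚ.+-identityˡ _ ⟩
    (- 1ℚ) * v i                                        ∎
    where
    e = seidelEntry (lookup b i)
    shift : ∀ m w e → m ≡ (m + w + 0ℚ * e) + (- 1ℚ) * w
    shift = solve-∀ ℚ-ring

  laterSum : (b : List Bool) → (Fin (length b) → ℚ) → ℚ
  laterSum b w = sumFin (length b) (λ j → seidelEntry (lookup b j) * w j)

  kernelRow-zero : ∀ x b a v →
    kernelRow (x ∷ b) a v zero ≡ laterSum b (v ∘ suc) + v zero + a * seidelEntry x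
  kernelRow-zero x b a v = cong (λ z → z + v zero + a * seidelEntry x) (begin
    0ℚ * v zero + sumFin (length b) (λ j → seidel (x ∷ b) zero (suc j) * v (suc j))
      ≡⟨ cong₂ _+_ (ℚ.*-zeroˡ (v zero))
                   (sumFin-cong (length b) (λ j → cong (_* v (suc j)) (seidel-zero-suc x b j))) ⟩
    0ℚ + laterSum b (v ∘ suc)
      ≡⟨ ℚ.+-identityˡ _ ⟩
    laterSum b (v ∘ suc) ∎)

  mulVec-seidel-suc : ∀ x b v i →
    mulVec (seidel (x ∷ b)) v (suc i)
      ≡ seidelEntry (lookup b i) * v zero + mulVec (seidel b) (v ∘ suc) i
  mulVec-seidel-suc x b v i =
    cong₂ _+_ (cong (_* v zero) (seidel-suc-zero x b i))
              (sumFin-cong (length b) (λ j → cong (_* v (suc j)) (seidel-suc-suc x b i j)))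

  kernelRow-suc : ∀ x b a v i →
    kernelRow (x ∷ b) a v (suc i) ≡ kernelRow b (a + v zero) (v ∘ suc) i
  kernelRow-suc x b a v i = begin
    mulVec (seidel (x ∷ b)) v (suc i) + v (suc i) + a * e
      ≡⟨ cong (λ z → z + v (suc i) + a * e) (mulVec-seidel-suc x b v i) ⟩
    e * v zero + mulVec (seidel b) (v ∘ suc) i + v (suc i) + a * e
      ≡⟨ regroup e (v zero) (mulVec (seidel b) (v ∘ suc) i) (v (suc i)) a ⟩
    kernelRow b (a + v zero) (v ∘ suc) i ∎
    where
    e = seidelEntry (lookup b i)
    regroup : ∀ e v₀ m w a → e * v₀ + m + w + a * e ≡ m + w + (a + v₀) * e
    regroup = solve-∀ ℚ-ring

  KernelAfter-tail : ∀ x b a v → KernelAfter (x ∷ b) a v → KernelAfter b (a + v zero) (v ∘ suc)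
  KernelAfter-tail x b a v kernel i = trans (sym (kernelRow-suc x b a v i)) (kernel (suc i))

  KernelAfter-∷ : ∀ x b a v → kernelRow (x ∷ b) a v zero ≡ 0ℚ →
                  KernelAfter b (a + v zero) (v ∘ suc) → KernelAfter (x ∷ b) a v
  KernelAfter-∷ x b a v row₀≡0 kernel zero    = row₀≡0
  KernelAfter-∷ x b a v row₀≡0 kernel (suc i) = trans (kernelRow-suc x b a v i) (kernel i)

  -- For consecutive letters x = αᵢ, y = αᵢ₊₁, entries v₀ = vᵢ, v₁ = vᵢ₊₁ and a the sum of
  -- the entries before vᵢ, rows i and i + 1 of (S + I) v differ by 2 (transitionʳ − transitionˡ).
  transitionˡ : Bool → Bool → ℚ → ℚ → ℚ
  transitionˡ false false a v₁ = 0ℚ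
  transitionˡ true  false a v₁ = a
  transitionˡ true  true  a v₁ = v₁
  transitionˡ false true  a v₁ = v₁

  transitionʳ : Bool → Bool → ℚ → ℚ → ℚ
  transitionʳ false false a v₀ = 0ℚ
  transitionʳ true  false a v₀ = 0ℚ
  transitionʳ true  true  a v₀ = v₀
  transitionʳ false true  a v₀ = v₀ + a

  Transition : Bool → Bool → ℚ → ℚ → ℚ → Set
  Transition x y a v₀ v₁ = transitionˡ x y a v₁ ≡ transitionʳ x y a v₀

  rowDifference : ∀ x y a v₀ v₁ l →
    seidelEntry y * v₁ + l + v₀ + a * seidelEntry x
      ≡ (1ℚ + 1ℚ) * (transitionʳ x y a v₀ - transitionˡ x y a v₁)
        + (l + v₁ + (a + v₀) * seidelEntry y)
  rowDifference false false = identity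
    where
    identity : ∀ a v₀ v₁ l → 1ℚ * v₁ + l + v₀ + a * 1ℚ
                             ≡ (1ℚ + 1ℚ) * (0ℚ - 0ℚ) + (l + v₁ + (a + v₀) * 1ℚ)
    identity = solve-∀ ℚ-ring
  rowDifference true  false = identity
    where
    identity : ∀ a v₀ v₁ l → 1ℚ * v₁ + l + v₀ + a * (- 1ℚ)
                             ≡ (1ℚ + 1ℚ) * (0ℚ - a) + (l + v₁ + (a + v₀) * 1ℚ)
    identity = solve-∀ ℚ-ring
  rowDifference true  true  = identity
    where
    identity : ∀ a v₀ v₁ l → (- 1ℚ) * v₁ + l + v₀ + a * (- 1ℚ)
                             ≡ (1ℚ + 1ℚ) * (v₀ - v₁) + (l + v₁ + (a + v₀) * (- 1ℚ))
    identity = solve-∀ ℚ-ring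
  rowDifference false true  = identity
    where
    identity : ∀ a v₀ v₁ l → (- 1ℚ) * v₁ + l + v₀ + a * 1ℚ
                             ≡ (1ℚ + 1ℚ) * ((v₀ + a) - v₁) + (l + v₁ + (a + v₀) * (- 1ℚ))
    identity = solve-∀ ℚ-ring

  kernelRow-transition : ∀ x y r a v →
    kernelRow (x ∷ y ∷ r) a v zero
      ≡ (1ℚ + 1ℚ) * (transitionʳ x y a (v zero) - transitionˡ x y a (v (suc zero)))
        + kernelRow (y ∷ r) (a + v zero) (v ∘ suc) zero
  kernelRow-transition x y r a v = begin
    kernelRow (x ∷ y ∷ r) a v zero
      ≡⟨ kernelRow-zero x (y ∷ r) a v ⟩
    laterSum (y ∷ r) (v ∘ suc) + v zero + a * seidelEntry x
      ≡⟨ rowDifference x y a (v zero) (v (suc zero)) (laterSum r (λ j → v (suc (suc j)))) ⟩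
    difference + (laterSum r (λ j → v (suc (suc j))) + v (suc zero) + (a + v zero) * seidelEntry y)
      ≡⟨ cong (difference +_) (kernelRow-zero y r (a + v zero) (v ∘ suc)) ⟨
    difference + kernelRow (y ∷ r) (a + v zero) (v ∘ suc) zero ∎
    where
    difference = (1ℚ + 1ℚ) * (transitionʳ x y a (v zero) - transitionˡ x y a (v (suc zero)))

  KernelAfter⇒Transition : ∀ x y r a v → KernelAfter (x ∷ y ∷ r) a v →
                           Transition x y a (v zero) (v (suc zero))
  KernelAfter⇒Transition x y r a v kernel =
    sym (x∙y⁻¹≈ε⇒x≈y _ _ (*-cancelˡ-≡0 (1ℚ + 1ℚ) _ difference≡0))
    where
    difference = (1ℚ + 1ℚ) * (transitionʳ x y a (v zero) - transitionˡ x y a (v (suc zero)))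
    difference≡0 : difference ≡ 0ℚ
    difference≡0 = begin
      difference
        ≡⟨ ℚ.+-identityʳ difference ⟨
      difference + 0ℚ
        ≡⟨ cong (difference +_) (KernelAfter-tail x (y ∷ r) a v kernel zero) ⟨
      difference + kernelRow (y ∷ r) (a + v zero) (v ∘ suc) zero
        ≡⟨ kernelRow-transition x y r a v ⟨
      kernelRow (x ∷ y ∷ r) a v zero
        ≡⟨ kernel zero ⟩
      0ℚ ∎

  Transition⇒KernelAfter : ∀ x y r a v → Transition x y a (v zero) (v (suc zero)) →
    KernelAfter (y ∷ r) (a + v zero) (v ∘ suc) → KernelAfter (x ∷ y ∷ r) a v
  Transition⇒KernelAfter x y r a v transition kernel = KernelAfter-∷ x (y ∷ r) a v (begin
    kernelRow (x ∷ y ∷ r) a v zero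
      ≡⟨ kernelRow-transition x y r a v ⟩
    (1ℚ + 1ℚ) * (t - transitionˡ x y a (v (suc zero)))
      + kernelRow (y ∷ r) (a + v zero) (v ∘ suc) zero
      ≡⟨ cong₂ (λ tˡ row → (1ℚ + 1ℚ) * (t - tˡ) + row) transition (kernel zero) ⟩
    (1ℚ + 1ℚ) * (t - t) + 0ℚ
      ≡⟨ cancel t ⟩
    0ℚ ∎) kernel
    where
    t = transitionʳ x y a (v zero)
    cancel : ∀ t → (1ℚ + 1ℚ) * (t - t) + 0ℚ ≡ 0ℚ
    cancel = solve-∀ ℚ-ring

  Stepwise : (b : List Bool) → ℚ → (Fin (length b) → ℚ) → Set
  Stepwise []          a v = ⊤
  Stepwise (x ∷ [])    a v = v zero + a * seidelEntry x ≡ 0ℚ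
  Stepwise (x ∷ y ∷ r) a v =
    Transition x y a (v zero) (v (suc zero)) × Stepwise (y ∷ r) (a + v zero) (v ∘ suc)

  KernelAfter⇒Stepwise : ∀ b a v → KernelAfter b a v → Stepwise b a v
  KernelAfter⇒Stepwise []          a v kernel = _
  KernelAfter⇒Stepwise (x ∷ [])    a v kernel =
    trans (cong (_+ a * seidelEntry x) (sym (ℚ.+-identityˡ (v zero))))
          (trans (sym (kernelRow-zero x [] a v)) (kernel zero))
  KernelAfter⇒Stepwise (x ∷ y ∷ r) a v kernel =
    KernelAfter⇒Transition x y r a v kernel ,
    KernelAfter⇒Stepwise (y ∷ r) (a + v zero) (v ∘ suc) (KernelAfter-tail x (y ∷ r) a v kernel)

  Stepwise⇒KernelAfter : ∀ b a v → Stepwise b a v → KernelAfter b a v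
  Stepwise⇒KernelAfter []          a v _    = λ ()
  Stepwise⇒KernelAfter (x ∷ [])    a v last = KernelAfter-∷ x [] a v
    (trans (kernelRow-zero x [] a v)
           (trans (cong (_+ a * seidelEntry x) (ℚ.+-identityˡ (v zero))) last))
    (λ ())
  Stepwise⇒KernelAfter (x ∷ y ∷ r) a v (transition , rest) =
    Transition⇒KernelAfter x y r a v transition (Stepwise⇒KernelAfter (y ∷ r) _ _ rest)

  -- Extend values on the free coordinates to a kernel vector; kernelVector₀ continues a string
  -- starting with 0 after earlier entries of sum a, kernelVector₁ one starting with 1 after sum 0.
  kernelVector₀ : ∀ r → ℚ → (Fin (freeCount (false ∷ r)) → ℚ) → Fin (length (false ∷ r)) → ℚ
  kernelVector₁ : ∀ r → (Fin (freeCount (true ∷ r)) → ℚ) → Fin (length (true ∷ r)) → ℚ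

  kernelVector₀ []             a x zero       = - a
  kernelVector₀ (false ∷ r)    a x zero       = x zero
  kernelVector₀ (false ∷ r)    a x (suc i)    = kernelVector₀ r (a + x zero) (x ∘ suc) i
  kernelVector₀ (true ∷ [])    a x zero       = x zero
  kernelVector₀ (true ∷ [])    a x (suc zero) = a + x zero
  kernelVector₀ (true ∷ y ∷ r) a x zero       = - a
  kernelVector₀ (true ∷ y ∷ r) a x (suc i)    = kernelVector₁ (y ∷ r) x i

  kernelVector₁ r           x zero    = 0ℚ
  kernelVector₁ (true ∷ r)  x (suc i) = kernelVector₁ r x i
  kernelVector₁ (false ∷ r) x (suc i) = kernelVector₀ r 0ℚ x i

  kernelVector₀-free : ∀ r a x l → kernelVector₀ r a x (freeCoordinate (false ∷ r) l) ≡ x l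
  kernelVector₁-free : ∀ r x l → kernelVector₁ r x (freeCoordinate (true ∷ r) l) ≡ x l

  kernelVector₀-free (false ∷ r)    a x zero    = refl
  kernelVector₀-free (false ∷ r)    a x (suc l) = kernelVector₀-free r (a + x zero) (x ∘ suc) l
  kernelVector₀-free (true ∷ [])    a x zero    = refl
  kernelVector₀-free (true ∷ y ∷ r) a x l       = kernelVector₁-free (y ∷ r) x l

  kernelVector₁-free (true ∷ r)  x l = kernelVector₁-free r x l
  kernelVector₁-free (false ∷ r) x l = kernelVector₀-free r 0ℚ x l

  kernelVector₀-stepwise : ∀ r a x → Stepwise (false ∷ r) a (kernelVector₀ r a x)
  kernelVector₁-stepwise : ∀ r x → Stepwise (true ∷ r) 0ℚ (kernelVector₁ r x)

  kernelVector₀-stepwise []             a x = cancel a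
    where
    cancel : ∀ a → - a + a * 1ℚ ≡ 0ℚ
    cancel = solve-∀ ℚ-ring
  kernelVector₀-stepwise (false ∷ r)    a x = refl , kernelVector₀-stepwise r (a + x zero) (x ∘ suc)
  kernelVector₀-stepwise (true ∷ [])    a x = ℚ.+-comm a (x zero) , cancel (a + x zero)
    where
    cancel : ∀ p → p + p * (- 1ℚ) ≡ 0ℚ
    cancel = solve-∀ ℚ-ring
  kernelVector₀-stepwise (true ∷ y ∷ r) a x =
    sym (ℚ.+-inverseˡ a) ,
    subst (λ a′ → Stepwise (true ∷ y ∷ r) a′ (kernelVector₁ (y ∷ r) x))
          (sym (ℚ.+-inverseʳ a)) (kernelVector₁-stepwise (y ∷ r) x)

  kernelVector₁-stepwise []          x = refl
  kernelVector₁-stepwise (true ∷ r)  x = refl , kernelVector₁-stepwise r x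
  kernelVector₁-stepwise (false ∷ r) x = refl , kernelVector₀-stepwise r 0ℚ x

  +-≡0 : ∀ {p q} → p ≡ 0ℚ → q ≡ 0ℚ → p + q ≡ 0ℚ
  +-≡0 refl refl = refl

  -- Along a run of ones all entries equal some c while the running sum a grows by c per step;
  -- a must vanish where the run ends, and a stays a positive multiple of c, so c = 0.
  onesRun-vanishes : ∀ y r m .{{_ : Positive m}} a v →
    Stepwise (true ∷ y ∷ r) a v → a ≡ m * v zero → v zero ≡ 0ℚ
  onesRun-vanishes false r m a v (a≡0 , _) a≡mc =
    *-cancelˡ-≡0 m {{ℚ.pos⇒nonZero m}} (v zero) (trans (sym a≡mc) a≡0)
  onesRun-vanishes true [] m a v (v₁≡v₀ , last) a≡mc =
    *-cancelˡ-≡0 m {{ℚ.pos⇒nonZero m}} (v zero) (trans (sym a≡mc) a≡0)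
    where
    a≡0 : a ≡ 0ℚ
    a≡0 = begin
      a                                                    ≡⟨ split a (v zero) (v (suc zero)) ⟩
      (v (suc zero) - v zero) - (v (suc zero) + (a + v zero) * (- 1ℚ))
        ≡⟨ cong₂ _-_ (trans (cong (_- v zero) v₁≡v₀) (ℚ.+-inverseʳ (v zero))) last ⟩
      0ℚ - 0ℚ                                              ≡⟨⟩
      0ℚ                                                   ∎
      where
      split : ∀ a v₀ v₁ → a ≡ (v₁ - v₀) - (v₁ + (a + v₀) * (- 1ℚ))
      split = solve-∀ ℚ-ring
  onesRun-vanishes true (y ∷ r) m a v (v₁≡v₀ , rest) a≡mc =
    trans (sym v₁≡v₀)
          (onesRun-vanishes y r (m + 1ℚ) {{ℚ.pos+pos⇒pos m 1ℚ}} (a + v zero) (v ∘ suc) rest a′≡m′c)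
    where
    factor : ∀ m c → m * c + c ≡ (m + 1ℚ) * c
    factor = solve-∀ ℚ-ring
    a′≡m′c : a + v zero ≡ (m + 1ℚ) * v (suc zero)
    a′≡m′c = begin
      a + v zero              ≡⟨ cong (_+ v zero) a≡mc ⟩
      m * v zero + v zero     ≡⟨ factor m (v zero) ⟩
      (m + 1ℚ) * v zero       ≡⟨ cong ((m + 1ℚ) *_) v₁≡v₀ ⟨
      (m + 1ℚ) * v (suc zero) ∎

  zeroThenOnes-vanish : ∀ y r v → Stepwise (false ∷ true ∷ y ∷ r) 0ℚ v →
                        v zero ≡ 0ℚ × v (suc zero) ≡ 0ℚ
  zeroThenOnes-vanish y r v (v₁≡v₀+0 , rest) = trans v₀≡v₁ v₁≡0 , v₁≡0
    where
    v₀≡v₁ : v zero ≡ v (suc zero)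
    v₀≡v₁ = trans (sym (ℚ.+-identityʳ (v zero))) (sym v₁≡v₀+0)
    v₁≡0 : v (suc zero) ≡ 0ℚ
    v₁≡0 = onesRun-vanishes y r 1ℚ (0ℚ + v zero) (v ∘ suc) rest
      (trans (ℚ.+-identityˡ (v zero)) (trans v₀≡v₁ (sym (ℚ.*-identityˡ (v (suc zero))))))

  stepwise₀-vanishes : ∀ r a v → Stepwise (false ∷ r) a v → a ≡ 0ℚ →
    (∀ l → v (freeCoordinate (false ∷ r) l) ≡ 0ℚ) → ∀ i → v i ≡ 0ℚ
  stepwise₁-vanishes : ∀ r a v → Stepwise (true ∷ r) a v → a ≡ 0ℚ → v zero ≡ 0ℚ →
    (∀ l → v (freeCoordinate (true ∷ r) l) ≡ 0ℚ) → ∀ i → v i ≡ 0ℚ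

  stepwise₀-vanishes [] a v last refl free zero = trans (sym (ℚ.+-identityʳ (v zero))) last
  stepwise₀-vanishes (false ∷ r) a v (_ , rest) a≡0 free zero    = free zero
  stepwise₀-vanishes (false ∷ r) a v (_ , rest) a≡0 free (suc i) =
    stepwise₀-vanishes r (a + v zero) (v ∘ suc) rest (+-≡0 a≡0 (free zero)) (free ∘ suc) i
  stepwise₀-vanishes (true ∷ []) a v (v₁≡v₀+a , _) a≡0 free zero       = free zero
  stepwise₀-vanishes (true ∷ []) a v (v₁≡v₀+a , _) a≡0 free (suc zero) =
    trans v₁≡v₀+a (+-≡0 (free zero) a≡0)
  stepwise₀-vanishes (true ∷ y ∷ r) a v stepwise refl free zero =
    proj₁ (zeroThenOnes-vanish y r v stepwise)
  stepwise₀-vanishes (true ∷ y ∷ r) a v stepwise refl free (suc i) =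
    stepwise₁-vanishes (y ∷ r) (0ℚ + v zero) (v ∘ suc) (proj₂ stepwise)
      (trans (ℚ.+-identityˡ (v zero)) v₀≡0) v₁≡0 free i
    where
    v₀≡0 = proj₁ (zeroThenOnes-vanish y r v stepwise)
    v₁≡0 = proj₂ (zeroThenOnes-vanish y r v stepwise)

  stepwise₁-vanishes r a v _ a≡0 v₀≡0 free zero = v₀≡0
  stepwise₁-vanishes (true ∷ r) a v (v₁≡v₀ , rest) a≡0 v₀≡0 free (suc i) =
    stepwise₁-vanishes r (a + v zero) (v ∘ suc) rest (+-≡0 a≡0 v₀≡0) (trans v₁≡v₀ v₀≡0) free i
  stepwise₁-vanishes (false ∷ r) a v (_ , rest) a≡0 v₀≡0 free (suc i) =
    stepwise₀-vanishes r (a + v zero) (v ∘ suc) rest (+-≡0 a≡0 v₀≡0) free i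

  -- Every threshold string starts with 0.
  seidel-multiplicity : ∀ {b} → ∃ (λ r → b ≡ false ∷ r) →
                        EigMultiplicity (seidel b) (- 1ℚ) (freeCount b)
  seidel-multiplicity (r , refl) =
    EigMultiplicity-fromCoordinates (seidel b) (- 1ℚ) (freeCoordinate b) (kernelVector₀ r 0ℚ)
      (λ x → KernelAfter⇒InEigenspace b _
               (Stepwise⇒KernelAfter b 0ℚ _ (kernelVector₀-stepwise r 0ℚ x)))
      (kernelVector₀-free r 0ℚ)
      (λ v eigen → stepwise₀-vanishes r 0ℚ v
                     (KernelAfter⇒Stepwise b 0ℚ v (InEigenspace⇒KernelAfter b v eigen)) refl)
    where
    b = false ∷ r

open ThresholdSeidel using (seidel-multiplicity)

open import Data.Nat using (_+_; _∸_; _≤_; _<_; z≤n; s≤s)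
open import Data.Nat.Properties using (+-identityʳ; +-assoc; +-∸-assoc; +-mono-≤)

isOne : ℕ → ℕ
isOne 1 = 1
isOne _ = 0

isOne-1< : ∀ {t} → 1 < t → isOne t ≡ 0
isOne-1< {suc (suc t)} _           = refl
isOne-1< {suc zero}    (s≤s ())

freeCount-ones : ∀ t R → freeCount (replicate t true ++ R) ≡ freeCount R
freeCount-ones zero    R = refl
freeCount-ones (suc t) R = freeCount-ones t R

freeCount-zeros : ∀ s X →
  freeCount (replicate (suc s) false ++ true ∷ X) ≡ s + freeCount (false ∷ true ∷ X)
freeCount-zeros zero    X = refl
freeCount-zeros (suc s) X = cong suc (freeCount-zeros s X)

freeCount-block : ∀ s t R → 1 ≤ s → 1 ≤ t →
  freeCount (replicate s false ++ replicate t true ++ R)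
    ≡ (s ∸ 1) + freeCount (false ∷ true ∷ replicate (t ∸ 1) true ++ R)
freeCount-block (suc s) (suc t) R _ _ = freeCount-zeros s (replicate t true ++ R)

freeCount-01-end : ∀ t → 1 ≤ t →
  freeCount (false ∷ true ∷ replicate (t ∸ 1) true ++ []) ≡ isOne t
freeCount-01-end (suc zero)    _ = refl
freeCount-01-end (suc (suc t)) _ = freeCount-ones t []

freeCount-01-∷ : ∀ t {R} → ∃ (λ r → R ≡ false ∷ r) →
                 freeCount (false ∷ true ∷ replicate t true ++ R) ≡ freeCount R
freeCount-01-∷ zero    (r , refl) = refl
freeCount-01-∷ (suc t) (r , refl) = freeCount-ones t (false ∷ r)

blockString-head : ∀ k s t → 1 ≤ s zero → ∃ λ r → blockString (suc k) s t ≡ false ∷ r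
blockString-head k s t 1≤s₀ with s zero | 1≤s₀
... | suc _ | s≤s z≤n = _ , refl

freeCount-blockString : ∀ k s t → (∀ i → 1 ≤ s i) → (∀ i → 1 ≤ t i) →
  freeCount (blockString (suc k) s t) ≡ sumℕ (suc k) (λ i → s i ∸ 1) + isOne (t (fromℕ k))
freeCount-blockString zero s t 1≤s 1≤t = begin
  freeCount (replicate (s zero) false ++ replicate (t zero) true ++ [])
    ≡⟨ freeCount-block (s zero) (t zero) [] (1≤s zero) (1≤t zero) ⟩
  (s zero ∸ 1) + freeCount (false ∷ true ∷ replicate (t zero ∸ 1) true ++ [])
    ≡⟨ cong₂ _+_ (sym (+-identityʳ (s zero ∸ 1))) (freeCount-01-end (t zero) (1≤t zero)) ⟩
  (s zero ∸ 1) + 0 + isOne (t zero) ∎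
  where open ≡-Reasoning
freeCount-blockString (suc k) s t 1≤s 1≤t = begin
  freeCount (replicate (s zero) false ++ replicate (t zero) true ++ rest)
    ≡⟨ freeCount-block (s zero) (t zero) rest (1≤s zero) (1≤t zero) ⟩
  (s zero ∸ 1) + freeCount (false ∷ true ∷ replicate (t zero ∸ 1) true ++ rest)
    ≡⟨ cong ((s zero ∸ 1) +_) (freeCount-01-∷ (t zero ∸ 1) rest-head) ⟩
  (s zero ∸ 1) + freeCount rest
    ≡⟨ cong ((s zero ∸ 1) +_)
            (freeCount-blockString k (s ∘ suc) (t ∘ suc) (1≤s ∘ suc) (1≤t ∘ suc)) ⟩
  (s zero ∸ 1) + (sumℕ (suc k) (λ i → s (suc i) ∸ 1) + isOne (t (fromℕ (suc k))))
    ≡⟨ +-assoc (s zero ∸ 1) _ _ ⟨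
  sumℕ (suc (suc k)) (λ i → s i ∸ 1) + isOne (t (fromℕ (suc k))) ∎
  where
  open ≡-Reasoning
  rest = blockString (suc k) (s ∘ suc) (t ∘ suc)
  rest-head = blockString-head k (s ∘ suc) (t ∘ suc) (1≤s (suc zero))

sumℕ≥ : ∀ n s → (∀ i → 1 ≤ s i) → n ≤ sumℕ n s
sumℕ≥ zero    s 1≤s = z≤n
sumℕ≥ (suc n) s 1≤s = +-mono-≤ (1≤s zero) (sumℕ≥ n (s ∘ suc) (1≤s ∘ suc))

sumℕ-∸ : ∀ n s → (∀ i → 1 ≤ s i) → sumℕ n s ∸ n ≡ sumℕ n (λ i → s i ∸ 1)
sumℕ-∸ zero    s 1≤s = refl
sumℕ-∸ (suc n) s 1≤s = begin
  (s zero + sumℕ n (s ∘ suc)) ∸ suc n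
    ≡⟨ peel (1≤s zero) (sumℕ≥ n (s ∘ suc) (1≤s ∘ suc)) ⟩
  (s zero ∸ 1) + (sumℕ n (s ∘ suc) ∸ n)
    ≡⟨ cong ((s zero ∸ 1) +_) (sumℕ-∸ n (s ∘ suc) (1≤s ∘ suc)) ⟩
  (s zero ∸ 1) + sumℕ n (λ i → s (suc i) ∸ 1) ∎
  where
  open ≡-Reasoning
  peel : ∀ {s₀ X} → 1 ≤ s₀ → n ≤ X → (s₀ + X) ∸ suc n ≡ (s₀ ∸ 1) + (X ∸ n)
  peel {suc s₀} _ n≤X = +-∸-assoc s₀ n≤X

mainTheorem6 : (k : ℕ) (s t : Fin (suc k) → ℕ)
    → (∀ i → 1 ≤ s i) → (∀ i → 1 ≤ t i)
    → (1 < t (fromℕ k) → EigMultiplicity (seidel (blockString (suc k) s t)) (- 1ℚ) (sumℕ (suc k) s ∸ suc k))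
      × (t (fromℕ k) ≡ 1 → EigMultiplicity (seidel (blockString (suc k) s t)) (- 1ℚ) ((sumℕ (suc k) s ∸ suc k) + 1))
mainTheorem6 k s t 1≤s 1≤t =
    (λ 1<tₖ → subst (EigMultiplicity S (- 1ℚ))
                    (trans count (trans (cong (n +_) (isOne-1< 1<tₖ)) (+-identityʳ n))) multiplicity)
  , (λ tₖ≡1 → subst (EigMultiplicity S (- 1ℚ))
                    (trans count (cong (λ tₖ → n + isOne tₖ) tₖ≡1)) multiplicity)
  where
  b = blockString (suc k) s t
  S = seidel b
  n = sumℕ (suc k) s ∸ suc k
  multiplicity : EigMultiplicity S (- 1ℚ) (freeCount b)
  multiplicity = seidel-multiplicity (blockString-head k s t (1≤s zero))
  count : freeCount b ≡ n + isOne (t (fromℕ k))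
  count = trans (freeCount-blockString k s t 1≤s 1≤t)
                (cong (_+ isOne (t (fromℕ k))) (sym (sumℕ-∸ (suc k) s 1≤s)))
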